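{- Fix positive integers $k<d$ and let $G=G(k,d)$. Then for each $c\in[d]$, the graph $G_{[d]\setminus\{c\}}$ admits a graphical shelling $\alpha,w^1,w^2,\ldots,w^{\binom{d-1}{k}}$ with $|R(w^j)|=k$ for each $j\ge1$.
   Context: $W_d$ is the set of words of length $d$ over $\{0,1\}$ with first letter $1$; each word is a concatenation of maximal constant nonempty subwords called blocks; $W_d(k)$ is the set of words with exactly $k+1$ blocks. $G'(k,d)$ is the edge-labeled multigraph on $W_d(k)$ with an edge labeled $j$ between two words differing only in position $j$. $G(k,d)$ adds a vertex $\alpha$ and, for each $w\in W_d(k)$ and each $j$ such that $w_j$ is in a block of size one, an edge labeled $j$ from $w$ to $\alpha$. For $S\subseteq[d]$, $G_S$ is the spanning subgraph with the edges whose labels lie in $S$. For a connected multigraph $H$ with edges colored by elements of a finite set $C$, a linear ordering $F_1,\dots,F_r$ of its vertices is a graphical shelling if for each $i\ge1$ the set $\{S\subseteq C:$ every path in $H$ from $F_i$ to some $F_j$ with $j<i$ uses an edge with color in $S\}$ has a unique minimal element, denoted $R(F_i)$. -}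

module Defs where

open import Data.Nat using (ℕ; zero; suc; _<_)
open import Data.Bool using (Bool; true; false; if_then_else_; _xor_)
open import Data.Vec using (Vec; []; _∷_; lookup)
open import Data.Fin using (Fin; toℕ)
open import Data.Fin.Subset using (Subset; _⊆_) renaming (_∈_ to _∈ₛ_)
open import Data.List using (List; length) renaming (lookup to lookupL)
open import Data.List.Membership.Propositional using (_∈_)
open import Data.List.Relation.Unary.Unique.Propositional using (Unique)
open import Data.Product using (Σ; _×_)
open import Data.Empty using (⊥)
open import Data.Unit using (⊤)
open import Function.Bundles using (_⇔_)
open import Relation.Nullary using (¬_)
open import Relation.Binary.PropositionalEquality using (_≡_; _≢_)

-- Words over {0,1} are Vec Bool d (true = 1).

changes : ∀ {n} → Bool → Vec Bool n → ℕ
changes x [] = 0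
changes x (y ∷ ys) = (if x xor y then 1 else 0) Data.Nat.+ changes y ys

nblocks : ∀ {n} → Vec Bool n → ℕ
nblocks [] = 0
nblocks (x ∷ xs) = suc (changes x xs)

FirstOne : ∀ {n} → Vec Bool n → Set
FirstOne [] = ⊥
FirstOne (x ∷ _) = x ≡ true

InW : (k : ℕ) → ∀ {d} → Vec Bool d → Set
InW k w = FirstOne w × nblocks w ≡ suc k

SingletonBlock : ∀ {d} → Vec Bool d → Fin d → Set
SingletonBlock w j =
  (∀ i → suc (toℕ i) ≡ toℕ j → lookup w i ≢ lookup w j) ×
  (∀ i → toℕ i ≡ suc (toℕ j) → lookup w i ≢ lookup w j)

DifferOnlyAt : ∀ {d} → Vec Bool d → Vec Bool d → Fin d → Set
DifferOnlyAt u v j = lookup u j ≢ lookup v j × (∀ i → i ≢ j → lookup u i ≡ lookup v i)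

-- vertices of G(k,d): the extra vertex α and words (only words in W_d(k) are vertices)
data Vtx (d : ℕ) : Set where
  α  : Vtx d
  wd : Vec Bool d → Vtx d

IsVertex : (k : ℕ) → ∀ {d} → Vtx d → Set
IsVertex k α = ⊤
IsVertex k (wd w) = InW k w

data Edge (k : ℕ) {d : ℕ} : Fin d → Vtx d → Vtx d → Set where
  ww : ∀ {u v j} → InW k u → InW k v → DifferOnlyAt u v j → Edge k j (wd u) (wd v)
  wα : ∀ {w j} → InW k w → SingletonBlock w j → Edge k j (wd w) α
  αw : ∀ {w j} → InW k w → SingletonBlock w j → Edge k j α (wd w)

data Walk (k : ℕ) {d : ℕ} (Allowed : Fin d → Set) : Vtx d → Vtx d → Set where
  here : ∀ {x} → Walk k Allowed x x
  step : ∀ {x y z} (j : Fin d) → Allowed j → Edge k j x y → Walk k Allowed y z → Walk k Allowed x z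

-- In the graph G_T (edges with labels in T), colour set C = [d]:
-- S separates position i of the ordering L from all earlier positions, i.e.
-- every path in G_T from F_i to some F_j (j < i) uses an edge with colour in S.
Separates : (k : ℕ) → ∀ {d} → Subset d → (L : List (Vtx d)) → Fin (length L) → Subset d → Set
Separates k T L i S =
  ∀ (j : Fin (length L)) → toℕ j < toℕ i →
    ¬ Walk k (λ l → l ∈ₛ T × ¬ (l ∈ₛ S)) (lookupL L i) (lookupL L j)

Minimal : ∀ {d} → (Subset d → Set) → Subset d → Set
Minimal P R = P R × (∀ S → P S → S ⊆ R → S ≡ R)

UniqueMinimal : ∀ {d} → (Subset d → Set) → Set
UniqueMinimal P = Σ _ λ R → Minimal P R × (∀ R' → Minimal P R' → R' ≡ R)

IsVertexOrdering : (k : ℕ) → ∀ {d} → List (Vtx d) → Set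
IsVertexOrdering k L = Unique L × (∀ v → (v ∈ L) ⇔ IsVertex k v)

IsGraphicalShelling : (k : ℕ) → ∀ {d} → Subset d → List (Vtx d) → Set
IsGraphicalShelling k T L =
  IsVertexOrdering k L × (∀ i → UniqueMinimal (Separates k T L i))

module Submission where

-- Fix c and read every word outward from position c along its two rays.  Let
-- R(w) consist of the letter on the far side of each switch of w, so that
-- |R(w)| = k.  On each ray, a word v agreeing with w on R(w) ∪ {c} has a switch
-- between any two consecutive such letters, hence at least as many switches as
-- w; and the binary number formed by its switch indicators, most significant
-- digit next to c, is at least that of w, with equality only if v = w.  Walks
-- avoiding the colours R(w) ∪ {c} preserve this agreement and never reach α,
-- since flipping an isolated letter outside R(w) ∪ {c} would leave fewer
-- switches than w has.  So if the words are listed by these numbers, R(w)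
-- separates w from all earlier vertices.  Conversely every letter of R(w) is
-- either isolated (an edge to α) or can be flipped to move its switch towards
-- c, which lowers the number, so every separating set contains R(w).

open import Data.Bool using (Bool; true; false; not; _xor_; if_then_else_)
open import Data.Bool.Properties using (¬-not; not-¬) renaming (_≟_ to _≟ᵇ_)
open import Data.Empty using (⊥; ⊥-elim)
open import Data.Fin using (Fin; toℕ; fromℕ<) renaming (zero to fzero; suc to fsuc)
open import Data.Fin.Properties using (toℕ-fromℕ<; toℕ-injective; toℕ<n; toℕ≤pred[n])
open import Data.Fin.Subset using (Subset; ∁; ⁅_⁆; ∣_∣; _⊆_) renaming (_∈_ to _∈ₛ_; ⊥ to ∅)
open import Data.Fin.Subset.Properties using (x∈∁p⇒x∉p; x∉p⇒x∈∁p; x≢y⇒x∉⁅y⁆; x∈⁅x⁆; ⊆-antisym; ⊥⊆; _∈?_)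
import Data.List as List
open import Data.List using (List; []; _∷_; map; _++_; length)
open import Data.List.Properties using (length-map; length-++)
open import Data.List.Membership.Propositional using (_∈_)
open import Data.List.Membership.Propositional.Properties
  using (∈-map⁺; ∈-map⁻; ∈-++⁺ˡ; ∈-++⁺ʳ; ∈-++⁻; ∈-lookup)
open import Data.List.Relation.Binary.Permutation.Propositional using (↭-sym; ↭⇒↭ₛ)
open import Data.List.Relation.Binary.Permutation.Propositional.Properties using (∈-resp-↭; ↭-length)
import Data.List.Relation.Unary.All as All
import Data.List.Relation.Unary.AllPairs as AllPairs
open import Data.List.Relation.Unary.AllPairs using (AllPairs; []; _∷_)
import Data.List.Relation.Unary.AllPairs.Properties as AllPairsₚ
open import Data.List.Relation.Unary.Any using (here; there; index)
open import Data.List.Relation.Unary.Any.Properties using (lookup-index)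
open import Data.List.Relation.Unary.Sorted.TotalOrder.Properties using (Sorted⇒AllPairs)
open import Data.List.Relation.Unary.Unique.Propositional using (Unique)
import Data.List.Relation.Unary.Unique.Propositional.Properties as Unique
open import Data.Nat using (ℕ; zero; suc; pred; >-nonZero; _+_; _*_; _^_; _∸_; _≤_; _<_; z≤n; s≤s)
open import Data.Nat.Combinatorics using (_C_; nCk+nC[k+1]≡[n+1]C[k+1])
open import Data.Nat.Properties
open import Data.Product using (Σ; _×_; _,_; proj₁; proj₂)
open import Data.Sum using (_⊎_; inj₁; inj₂)
open import Data.Unit using (tt)
open import Data.Vec using (Vec; []; _∷_; lookup; tabulate)
open import Data.Vec.Properties using (∷-injectiveˡ; ∷-injectiveʳ; []=⇒lookup; lookup⇒[]=; lookup∘tabulate)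
open import Function using (_∘_)
open import Function.Bundles using (_⇔_; mk⇔; Equivalence)
open import Relation.Binary.Bundles using (DecTotalOrder)
import Relation.Binary.Construct.On as On
open import Relation.Binary.Definitions using (tri<; tri≈; tri>)
open import Relation.Binary.PropositionalEquality
open import Relation.Nullary using (¬_; Dec; yes; no; contradiction)
open import Relation.Nullary.Decidable using (decidable-stable)

open import Defs

-- Switches of a 0/1 sequence

differ : Bool → Bool → ℕ
differ x y = if x xor y then 1 else 0

differ-sym : ∀ x y → differ x y ≡ differ y x
differ-sym false false = refl
differ-sym false true  = refl
differ-sym true  false = refl
differ-sym true  true  = refl

differ-≡ : ∀ {x y} → x ≡ y → differ x y ≡ 0
differ-≡ {false} refl = refl
differ-≡ {true}  refl = refl

differ-≢ : ∀ {x y} → x ≢ y → differ x y ≡ 1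
differ-≢ {false} {false} x≢y = contradiction refl x≢y
differ-≢ {false} {true}  _   = refl
differ-≢ {true}  {false} _   = refl
differ-≢ {true}  {true}  x≢y = contradiction refl x≢y

differ≤1 : ∀ x y → differ x y ≤ 1
differ≤1 false false = z≤n
differ≤1 false true  = ≤-refl
differ≤1 true  false = ≤-refl
differ≤1 true  true  = z≤n

differ-triangle : ∀ x y z → differ x z ≤ differ x y + differ y z
differ-triangle false false z     = ≤-refl
differ-triangle true  true  z     = ≤-refl
differ-triangle false true  false = z≤n
differ-triangle false true  true  = ≤-refl
differ-triangle true  false false = ≤-refl
differ-triangle true  false true  = z≤n

differ-through : ∀ x y z → x ≢ z → differ x y + differ y z ≡ 1
differ-through false false true  _   = refl
differ-through false true  true  _   = refl
differ-through true  false false _   = refl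
differ-through true  true  false _   = refl
differ-through false _     false x≢z = contradiction refl x≢z
differ-through true  _     true  x≢z = contradiction refl x≢z

differ-detour-≤ : ∀ x y x' y' → (x ≢ y → y' ≡ y) →
                  differ x y + differ y y' ≤ differ x x' + differ x' y'
differ-detour-≤ false false x' y' _ = differ-triangle false x' y'
differ-detour-≤ true  true  x' y' _ = differ-triangle true x' y'
differ-detour-≤ false true  x' y' h rewrite h (λ ()) = differ-triangle false x' true
differ-detour-≤ true  false x' y' h rewrite h (λ ()) = differ-triangle true x' false

differ-≤ : ∀ x y y' → (y' ≢ y → x ≢ y) → differ x y' ≤ differ x y
differ-≤ x y y' h with y' ≟ᵇ y
... | yes refl = ≤-refl
... | no y'≢y  = subst (differ x y' ≤_) (sym (differ-≢ (h y'≢y))) (differ≤1 x y')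

≢-≢⇒≡ : ∀ {x y z : Bool} → x ≢ z → y ≢ z → x ≡ y
≢-≢⇒≡ x≢z y≢z = trans (¬-not x≢z) (sym (¬-not y≢z))

xor≡true⇒≢ : ∀ {x y} → x xor y ≡ true → x ≢ y
xor≡true⇒≢ {false} {true}  _ = λ ()
xor≡true⇒≢ {true}  {false} _ = λ ()

≢⇒xor≡true : ∀ {x y} → x ≢ y → x xor y ≡ true
≢⇒xor≡true {false} {false} x≢y = contradiction refl x≢y
≢⇒xor≡true {false} {true}  _   = refl
≢⇒xor≡true {true}  {false} _   = refl
≢⇒xor≡true {true}  {true}  x≢y = contradiction refl x≢y

count : (ℕ → Bool) → ℕ → ℕ
count b zero    = 0
count b (suc n) = (if b 0 then 1 else 0) + count (b ∘ suc) n

count-cong : ∀ n b b' → (∀ t → t < n → b t ≡ b' t) → count b n ≡ count b' n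
count-cong zero    b b' b≗b' = refl
count-cong (suc n) b b' b≗b' =
  cong₂ _+_ (cong (λ x → if x then 1 else 0) (b≗b' 0 (s≤s z≤n)))
            (count-cong n (b ∘ suc) (b' ∘ suc) (λ t t<n → b≗b' (suc t) (s≤s t<n)))

count-split : ∀ a n b → count b (a + n) ≡ count b a + count (λ t → b (a + t)) n
count-split zero    n b = refl
count-split (suc a) n b =
  trans (cong ((if b 0 then 1 else 0) +_) (count-split a n (b ∘ suc)))
        (sym (+-assoc (if b 0 then 1 else 0) _ _))

switches : (ℕ → Bool) → ℕ → ℕ
switches g = count (λ t → g t xor g (suc t))

switches-cong : ∀ n g g' → (∀ t → t ≤ n → g t ≡ g' t) → switches g n ≡ switches g' n
switches-cong n g g' g≗g' =
  count-cong n _ _ (λ t t<n → cong₂ _xor_ (g≗g' t (<⇒≤ t<n)) (g≗g' (suc t) t<n))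

switches-split : ∀ a n g → switches g (a + n) ≡ switches g a + switches (λ t → g (a + t)) n
switches-split a n g =
  trans (count-split a n _)
        (cong (switches g a +_) (count-cong n _ _ (λ t _ → cong (λ x → g (a + t) xor g x) (sym (+-suc a t)))))

switches-snoc : ∀ n g → switches g (suc n) ≡ switches g n + differ (g n) (g (suc n))
switches-snoc zero    g = +-comm (differ (g 0) (g 1)) 0
switches-snoc (suc n) g =
  trans (cong (differ (g 0) (g 1) +_) (switches-snoc n (g ∘ suc)))
        (sym (+-assoc (differ (g 0) (g 1)) _ _))

switches-reverse : ∀ n g → switches (λ t → g (n ∸ t)) n ≡ switches g n
switches-reverse zero    g = refl
switches-reverse (suc n) g = begin
  differ (g (suc n)) (g n) + switches (λ t → g (n ∸ t)) n
    ≡⟨ cong₂ _+_ (differ-sym (g (suc n)) (g n)) (switches-reverse n g) ⟩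
  differ (g n) (g (suc n)) + switches g n
    ≡⟨ +-comm (differ (g n) (g (suc n))) (switches g n) ⟩
  switches g n + differ (g n) (g (suc n))
    ≡⟨ switches-snoc n g ⟨
  switches g (suc n)
    ∎
  where open ≡-Reasoning

switches-local : ∀ p n g g' → suc p < n → (∀ t → t ≢ suc p → g' t ≡ g t) →
  differ (g p) (g (suc p)) + differ (g (suc p)) (g (suc (suc p))) ≡
  differ (g' p) (g' (suc p)) + differ (g' (suc p)) (g' (suc (suc p))) →
  switches g n ≡ switches g' n
switches-local zero (suc zero) g g' (s≤s ()) _ _
switches-local zero (suc (suc n)) g g' _ agree local = begin
  differ (g 0) (g 1) + (differ (g 1) (g 2) + switches (g ∘ suc ∘ suc) n)
    ≡⟨ +-assoc (differ (g 0) (g 1)) _ _ ⟨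
  differ (g 0) (g 1) + differ (g 1) (g 2) + switches (g ∘ suc ∘ suc) n
    ≡⟨ cong₂ _+_ local (switches-cong n _ _ (λ t _ → sym (agree (suc (suc t)) (λ ())))) ⟩
  differ (g' 0) (g' 1) + differ (g' 1) (g' 2) + switches (g' ∘ suc ∘ suc) n
    ≡⟨ +-assoc (differ (g' 0) (g' 1)) _ _ ⟩
  differ (g' 0) (g' 1) + (differ (g' 1) (g' 2) + switches (g' ∘ suc ∘ suc) n)
    ∎
  where open ≡-Reasoning
switches-local (suc p) (suc n) g g' (s≤s p<n) agree local =
  cong₂ _+_ (cong₂ differ (sym (agree 0 (λ ()))) (sym (agree 1 (λ q → 1+n≢0 (sym (suc-injective q))))))
            (switches-local p n (g ∘ suc) (g' ∘ suc) p<n (λ t t≢p → agree (suc t) (t≢p ∘ suc-injective)) local)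

Isolated : (ℕ → Bool) → ℕ → ℕ → Set
Isolated g n p = (∀ s → suc s ≡ p → g s ≢ g p) × (p < n → g (suc p) ≢ g p)

switches-isolated-< : ∀ p n g g' → p ≤ n → 0 < n → Isolated g n p →
  (∀ t → t ≢ p → g' t ≡ g t) → g' p ≢ g p → switches g' n < switches g n
switches-isolated-< zero (suc n) g g' _ _ (_ , right) agree flipped = begin-strict
  differ (g' 0) (g' 1) + switches (g' ∘ suc) n  ≡⟨ cong₂ _+_ (differ-≡ g'0≡g'1) tails ⟩
  switches (g ∘ suc) n                          <⟨ n<1+n _ ⟩
  1 + switches (g ∘ suc) n                      ≡⟨ cong (_+ switches (g ∘ suc) n) head-switches ⟨
  differ (g 0) (g 1) + switches (g ∘ suc) n     ∎
  where
  open ≤-Reasoning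
  head-switches : differ (g 0) (g 1) ≡ 1
  head-switches = differ-≢ (right (s≤s z≤n) ∘ sym)
  g'0≡g'1 : g' 0 ≡ g' 1
  g'0≡g'1 = trans (≢-≢⇒≡ flipped (right (s≤s z≤n))) (sym (agree 1 (λ ())))
  tails : switches (g' ∘ suc) n ≡ switches (g ∘ suc) n
  tails = switches-cong n (g' ∘ suc) (g ∘ suc) (λ t _ → agree (suc t) (λ ()))
switches-isolated-< (suc zero) (suc zero) g g' _ _ (left , _) agree flipped
  rewrite differ-≡ (trans (agree 0 (λ ())) (sym (≢-≢⇒≡ flipped (left 0 refl))))
        | differ-≢ (left 0 refl) = s≤s z≤n
switches-isolated-< (suc p) (suc (suc n)) g g' (s≤s p≤n) _ (left , right) agree flipped =
  +-mono-≤-< head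
    (switches-isolated-< p (suc n) (g ∘ suc) (g' ∘ suc) p≤n (s≤s z≤n)
      ((λ s eq → left (suc s) (cong suc eq)) , right ∘ s≤s)
      (λ t t≢p → agree (suc t) (t≢p ∘ suc-injective)) flipped)
  where
  g'1≢g1⇒1≡p+1 : g' 1 ≢ g 1 → 1 ≡ suc p
  g'1≢g1⇒1≡p+1 ne = decidable-stable (1 ≟ suc p) (λ 1≢p → ne (agree 1 1≢p))
  head : differ (g' 0) (g' 1) ≤ differ (g 0) (g 1)
  head = subst (λ x → differ x (g' 1) ≤ differ (g 0) (g 1)) (sym (agree 0 (λ ())))
           (differ-≤ (g 0) (g 1) (g' 1)
             (λ ne → subst (λ q → g 0 ≢ g q) (sym (g'1≢g1⇒1≡p+1 ne)) (left 0 (g'1≢g1⇒1≡p+1 ne))))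

KeepsBlockStarts : (ℕ → Bool) → (ℕ → Bool) → ℕ → Set
KeepsBlockStarts g g' n = ∀ t → t < n → g t ≢ g (suc t) → g' (suc t) ≡ g (suc t)

KeepsBlockStarts-tail : ∀ g g' {n} → KeepsBlockStarts g g' (suc n) → KeepsBlockStarts (g ∘ suc) (g' ∘ suc) n
KeepsBlockStarts-tail g g' keeps t t<n = keeps (suc t) (s≤s t<n)

-- The extra summand absorbs a mismatch of the first letters, which may occur
-- for the tails.
switches-≤ : ∀ n g g' → KeepsBlockStarts g g' n → switches g n ≤ differ (g 0) (g' 0) + switches g' n
switches-≤ zero    g g' keeps = z≤n
switches-≤ (suc n) g g' keeps = begin
  differ (g 0) (g 1) + switches (g ∘ suc) n
    ≤⟨ +-monoʳ-≤ (differ (g 0) (g 1)) (switches-≤ n (g ∘ suc) (g' ∘ suc) (KeepsBlockStarts-tail g g' keeps)) ⟩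
  differ (g 0) (g 1) + (differ (g 1) (g' 1) + switches (g' ∘ suc) n)
    ≡⟨ +-assoc (differ (g 0) (g 1)) _ _ ⟨
  differ (g 0) (g 1) + differ (g 1) (g' 1) + switches (g' ∘ suc) n
    ≤⟨ +-monoˡ-≤ _ (differ-detour-≤ (g 0) (g 1) (g' 0) (g' 1) (keeps 0 (s≤s z≤n))) ⟩
  differ (g 0) (g' 0) + differ (g' 0) (g' 1) + switches (g' ∘ suc) n
    ≡⟨ +-assoc (differ (g 0) (g' 0)) _ _ ⟩
  differ (g 0) (g' 0) + (differ (g' 0) (g' 1) + switches (g' ∘ suc) n)
    ∎
  where open ≤-Reasoning

switches-mono : ∀ n g g' → g 0 ≡ g' 0 → KeepsBlockStarts g g' n → switches g n ≤ switches g' n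
switches-mono n g g' g0≡g'0 keeps =
  subst (λ δ → switches g n ≤ δ + switches g' n) (differ-≡ g0≡g'0) (switches-≤ n g g' keeps)

-- The switch code

switchCode : (ℕ → Bool) → ℕ → ℕ
switchCode g zero    = 0
switchCode g (suc n) = differ (g 0) (g 1) * 2 ^ n + switchCode (g ∘ suc) n

leading-digit-< : ∀ m a a' b b' → a < a' → b < 2 ^ m → a * 2 ^ m + b < a' * 2 ^ m + b'
leading-digit-< m a a' b b' a<a' b<2^m = begin-strict
  a * 2 ^ m + b      <⟨ +-monoʳ-< (a * 2 ^ m) b<2^m ⟩
  a * 2 ^ m + 2 ^ m  ≡⟨ +-comm (a * 2 ^ m) (2 ^ m) ⟩
  suc a * 2 ^ m      ≤⟨ *-monoˡ-≤ (2 ^ m) a<a' ⟩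
  a' * 2 ^ m         ≤⟨ m≤m+n (a' * 2 ^ m) b' ⟩
  a' * 2 ^ m + b'    ∎
  where open ≤-Reasoning

digits-≡ : ∀ m {a a' b b'} → a ≤ a' → b < 2 ^ m → a * 2 ^ m + b ≡ a' * 2 ^ m + b' → a ≡ a' × b ≡ b'
digits-≡ m {a} {a'} {b} {b'} a≤a' b<2^m eq with m≤n⇒m<n∨m≡n a≤a'
... | inj₁ a<a' = contradiction eq (<⇒≢ (leading-digit-< m a a' b b' a<a' b<2^m))
... | inj₂ refl = refl , +-cancelˡ-≡ (a * 2 ^ m) b b' eq

switchCode<2^n : ∀ n g → switchCode g n < 2 ^ n
switchCode<2^n zero    g = s≤s z≤n
switchCode<2^n (suc n) g = begin-strict
  differ (g 0) (g 1) * 2 ^ n + switchCode (g ∘ suc) n  <⟨ +-monoʳ-< _ (switchCode<2^n n (g ∘ suc)) ⟩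
  differ (g 0) (g 1) * 2 ^ n + 2 ^ n                   ≤⟨ +-monoˡ-≤ (2 ^ n) (*-monoˡ-≤ (2 ^ n) (differ≤1 (g 0) (g 1))) ⟩
  1 * 2 ^ n + 2 ^ n                                    ≡⟨ cong (_+ 2 ^ n) (*-identityˡ (2 ^ n)) ⟩
  2 ^ n + 2 ^ n                                        ≡⟨ cong (2 ^ n +_) (+-identityʳ (2 ^ n)) ⟨
  2 * 2 ^ n                                            ∎
  where open ≤-Reasoning

switchCode-cong : ∀ n g g' → (∀ t → t ≤ n → g t ≡ g' t) → switchCode g n ≡ switchCode g' n
switchCode-cong zero    g g' g≗g' = refl
switchCode-cong (suc n) g g' g≗g' =
  cong₂ _+_ (cong (_* 2 ^ n) (cong₂ differ (g≗g' 0 z≤n) (g≗g' 1 (s≤s z≤n))))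
            (switchCode-cong n (g ∘ suc) (g' ∘ suc) (λ t t≤n → g≗g' (suc t) (s≤s t≤n)))

switchCode-drop : ∀ n g g' s → s < n → (∀ u → u ≤ s → g' u ≡ g u) →
                  g s ≢ g (suc s) → g' s ≡ g' (suc s) → switchCode g' n < switchCode g n
switchCode-drop (suc n) g g' zero _ _ g-switches g'-stays
  rewrite differ-≢ g-switches | differ-≡ g'-stays =
  leading-digit-< n 0 1 _ _ (s≤s z≤n) (switchCode<2^n n (g' ∘ suc))
switchCode-drop (suc n) g g' (suc s) (s≤s s<n) agree g-switches g'-stays
  rewrite cong₂ differ (agree 0 z≤n) (agree 1 (s≤s z≤n)) =
  +-monoʳ-< (differ (g 0) (g 1) * 2 ^ n)
    (switchCode-drop n (g ∘ suc) (g' ∘ suc) s s<n (λ u u≤s → agree (suc u) (s≤s u≤s)) g-switches g'-stays)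

SwitchCodeBelow : (ℕ → Bool) → (ℕ → Bool) → ℕ → Set
SwitchCodeBelow g g' n =
  switchCode g n ≤ switchCode g' n × (switchCode g n ≡ switchCode g' n → ∀ t → t ≤ n → g' t ≡ g t)

switchCode-minimal : ∀ n g g' → g 0 ≡ g' 0 → KeepsBlockStarts g g' n → SwitchCodeBelow g g' n

switchCode-minimal-step : ∀ n g g' → g 0 ≡ g' 0 → g 1 ≡ g' 1 → KeepsBlockStarts g g' (suc n) →
                          SwitchCodeBelow g g' (suc n)
switchCode-minimal-step n g g' g0≡g'0 g1≡g'1 keeps = code≤ , code≡⇒≡
  where
  tails : SwitchCodeBelow (g ∘ suc) (g' ∘ suc) n
  tails = switchCode-minimal n (g ∘ suc) (g' ∘ suc) g1≡g'1 (KeepsBlockStarts-tail g g' keeps)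
  heads : differ (g 0) (g 1) * 2 ^ n ≡ differ (g' 0) (g' 1) * 2 ^ n
  heads = cong (_* 2 ^ n) (cong₂ differ g0≡g'0 g1≡g'1)
  code≤ : switchCode g (suc n) ≤ switchCode g' (suc n)
  code≤ = +-mono-≤ (≤-reflexive heads) (proj₁ tails)
  code≡⇒≡ : switchCode g (suc n) ≡ switchCode g' (suc n) → ∀ t → t ≤ suc n → g' t ≡ g t
  code≡⇒≡ _  zero    _         = sym g0≡g'0
  code≡⇒≡ eq (suc t) (s≤s t≤n) = proj₂ tails tails≡ t t≤n
    where
    tails≡ : switchCode (g ∘ suc) n ≡ switchCode (g' ∘ suc) n
    tails≡ = +-cancelˡ-≡ (differ (g' 0) (g' 1) * 2 ^ n) _ _
               (trans (cong (_+ switchCode (g ∘ suc) n) (sym heads)) eq)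

switchCode-minimal zero g g' g0≡g'0 keeps = z≤n , λ { _ zero _ → sym g0≡g'0 }
switchCode-minimal (suc n) g g' g0≡g'0 keeps with g 0 ≟ᵇ g 1 | g' 0 ≟ᵇ g' 1
... | yes g-stays | no g'-switches = <⇒≤ code< , λ eq → contradiction eq (<⇒≢ code<)
  where
  code< : switchCode g (suc n) < switchCode g' (suc n)
  code< = switchCode-drop (suc n) g' g 0 (s≤s z≤n) (λ { zero _ → g0≡g'0 }) g'-switches g-stays
... | yes g-stays | yes g'-stays =
  switchCode-minimal-step n g g' g0≡g'0 (trans (sym g-stays) (trans g0≡g'0 g'-stays)) keeps
... | no g-switches | _ =
  switchCode-minimal-step n g g' g0≡g'0 (sym (keeps 0 (s≤s z≤n) g-switches)) keeps

-- Letter t of a word; positions past the end read as false.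
at : ∀ {n} → Vec Bool n → ℕ → Bool
at []       _       = false
at (x ∷ xs) zero    = x
at (x ∷ xs) (suc t) = at xs t

lookup≡at : ∀ {n} (w : Vec Bool n) (i : Fin n) → lookup w i ≡ at w (toℕ i)
lookup≡at (x ∷ w) fzero    = refl
lookup≡at (x ∷ w) (fsuc i) = lookup≡at w i

at≡lookup : ∀ {n} (w : Vec Bool n) {t} (t<n : t < n) → at w t ≡ lookup w (fromℕ< t<n)
at≡lookup w t<n = trans (cong (at w) (sym (toℕ-fromℕ< t<n))) (sym (lookup≡at w (fromℕ< t<n)))

at-ext : ∀ {n} (v w : Vec Bool n) → (∀ t → t < n → at v t ≡ at w t) → v ≡ w
at-ext []      []      _   = refl
at-ext (x ∷ v) (y ∷ w) v≗w = cong₂ _∷_ (v≗w 0 (s≤s z≤n)) (at-ext v w (λ t t<n → v≗w (suc t) (s≤s t<n)))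

changes≡switches : ∀ {n} x (xs : Vec Bool n) → changes x xs ≡ switches (at (x ∷ xs)) n
changes≡switches x []       = refl
changes≡switches x (y ∷ ys) = cong (differ x y +_) (changes≡switches y ys)

InW⇒at : ∀ {k e} (w : Vec Bool (suc e)) → InW k w → at w 0 ≡ true × switches (at w) e ≡ k
InW⇒at (x ∷ xs) (first , blocks) = first , trans (sym (changes≡switches x xs)) (suc-injective blocks)

at⇒InW : ∀ {k e} (w : Vec Bool (suc e)) → at w 0 ≡ true → switches (at w) e ≡ k → InW k w
at⇒InW (x ∷ xs) first sw = first , cong suc (trans (changes≡switches x xs) sw)

SingletonBlock⇒Isolated : ∀ {e} (w : Vec Bool (suc e)) (j : Fin (suc e)) →
                          SingletonBlock w j → Isolated (at w) e (toℕ j)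
SingletonBlock⇒Isolated {e} w j (left , right) = left′ , right′
  where
  left′ : ∀ s → suc s ≡ toℕ j → at w s ≢ at w (toℕ j)
  left′ s s+1≡j eq = left i (trans (cong suc (toℕ-fromℕ< s<)) s+1≡j)
    (trans (sym (at≡lookup w s<)) (trans eq (sym (lookup≡at w j))))
    where
    s< : s < suc e
    s< = <-trans (subst (s <_) s+1≡j (n<1+n s)) (toℕ<n j)
    i = fromℕ< s<
  right′ : toℕ j < e → at w (suc (toℕ j)) ≢ at w (toℕ j)
  right′ j<e eq = right (fromℕ< (s≤s j<e)) (toℕ-fromℕ< (s≤s j<e))
    (trans (sym (at≡lookup w (s≤s j<e))) (trans eq (sym (lookup≡at w j))))

Isolated⇒SingletonBlock : ∀ {e} (w : Vec Bool (suc e)) (j : Fin (suc e)) →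
                          Isolated (at w) e (toℕ j) → SingletonBlock w j
Isolated⇒SingletonBlock w j (left , right) =
  (λ i i+1≡j eq → left (toℕ i) i+1≡j (trans (sym (lookup≡at w i)) (trans eq (lookup≡at w j)))) ,
  (λ i i≡j+1 eq → right (≤-pred (subst (_< _) i≡j+1 (toℕ<n i)))
    (trans (cong (at w) (sym i≡j+1)) (trans (sym (lookup≡at w i)) (trans eq (lookup≡at w j)))))

DifferOnlyAt⇒at : ∀ {n} {u v : Vec Bool n} {j} → DifferOnlyAt u v j →
                  ∀ t → t < n → t ≢ toℕ j → at v t ≡ at u t
DifferOnlyAt⇒at {u = u} {v} (_ , same) t t<n t≢j =
  trans (at≡lookup v t<n)
    (trans (sym (same (fromℕ< t<n) (λ i≡j → t≢j (trans (sym (toℕ-fromℕ< t<n)) (cong toℕ i≡j)))))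
           (sym (at≡lookup u t<n)))

flipAt : ∀ {n} → ℕ → Vec Bool n → Vec Bool n
flipAt _       []       = []
flipAt zero    (x ∷ xs) = not x ∷ xs
flipAt (suc p) (x ∷ xs) = x ∷ flipAt p xs

at-flipAt-≢ : ∀ {n} p (w : Vec Bool n) t → t ≢ p → at (flipAt p w) t ≡ at w t
at-flipAt-≢ p       []      t       _   = refl
at-flipAt-≢ zero    (x ∷ w) zero    t≢p = contradiction refl t≢p
at-flipAt-≢ zero    (x ∷ w) (suc t) _   = refl
at-flipAt-≢ (suc p) (x ∷ w) zero    _   = refl
at-flipAt-≢ (suc p) (x ∷ w) (suc t) t≢p = at-flipAt-≢ p w t (t≢p ∘ cong suc)

at-flipAt-≡ : ∀ {n} p (w : Vec Bool n) → p < n → at (flipAt p w) p ≡ not (at w p)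
at-flipAt-≡ zero    (x ∷ w) _         = refl
at-flipAt-≡ (suc p) (x ∷ w) (s≤s p<n) = at-flipAt-≡ p w p<n

flipAt-DifferOnlyAt : ∀ {n} (w : Vec Bool n) (j : Fin n) → DifferOnlyAt w (flipAt (toℕ j) w) j
flipAt-DifferOnlyAt w j = flipped , unchanged
  where
  v = flipAt (toℕ j) w
  flipped : lookup w j ≢ lookup v j
  flipped eq = not-¬ refl (trans (sym (lookup≡at w j))
                                 (trans eq (trans (lookup≡at v j) (at-flipAt-≡ (toℕ j) w (toℕ<n j)))))
  unchanged : ∀ i → i ≢ j → lookup w i ≡ lookup v i
  unchanged i i≢j = trans (lookup≡at w i)
    (trans (sym (at-flipAt-≢ (toℕ j) w (toℕ i) (i≢j ∘ toℕ-injective))) (sym (lookup≡at v i)))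

flipAt-InW : ∀ {k e} (w : Vec Bool (suc e)) p → suc p < e → at w p ≢ at w (suc (suc p)) →
             InW k w → InW k (flipAt (suc p) w)
flipAt-InW {e = e} w p p+1<e neighbours-differ inW =
  at⇒InW v (trans (at-flipAt-≢ (suc p) w 0 (λ ())) (proj₁ (InW⇒at w inW)))
    (trans (sym (switches-local p e (at w) (at v) p+1<e (at-flipAt-≢ (suc p) w) local))
           (proj₂ (InW⇒at w inW)))
  where
  v = flipAt (suc p) w
  v-neighbours-differ : at v p ≢ at v (suc (suc p))
  v-neighbours-differ
    rewrite at-flipAt-≢ (suc p) w p (1+n≢n ∘ sym) | at-flipAt-≢ (suc p) w (suc (suc p)) 1+n≢n =
    neighbours-differ
  local : differ (at w p) (at w (suc p)) + differ (at w (suc p)) (at w (suc (suc p))) ≡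
          differ (at v p) (at v (suc p)) + differ (at v (suc p)) (at v (suc (suc p)))
  local = trans (differ-through _ _ _ neighbours-differ) (sym (differ-through _ _ _ v-neighbours-differ))

at-flipAt-≢-neighbour : ∀ {n} p (w : Vec Bool n) → p < n → ∀ t → at w t ≢ at w p → at (flipAt p w) p ≡ at w t
at-flipAt-≢-neighbour p w p<n t differs = trans (at-flipAt-≡ p w p<n) (sym (¬-not differs))

flip-edge : ∀ {k e} (w : Vec Bool (suc e)) → InW k w → (l : Fin (suc e)) → ∀ p → toℕ l ≡ suc p →
            suc p < e → at w p ≢ at w (suc (suc p)) → Edge k l (wd w) (wd (flipAt (toℕ l) w))
flip-edge {k} w inW l p l≡p+1 p+1<e neighbours-differ =
  ww inW (subst (λ q → InW k (flipAt q w)) (sym l≡p+1) (flipAt-InW w p p+1<e neighbours-differ inW))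
     (flipAt-DifferOnlyAt w l)

-- Rays from the removed position

module Rays (e c : ℕ) (c≤e : c ≤ e) where

  Word : Set
  Word = Vec Bool (suc e)

  m : ℕ
  m = e ∸ c

  c+m≡e : c + m ≡ e
  c+m≡e = m+[n∸m]≡n c≤e

  leftRay rightRay : Word → ℕ → Bool
  leftRay  w t = at w (c ∸ t)
  rightRay w t = at w (c + t)

  rank : Word → ℕ
  rank w = switchCode (leftRay w) c * 2 ^ m + switchCode (rightRay w) m

  -- R(w): of each switch of w, the letter on the side away from c.  On each
  -- ray these are the first letters of all blocks but the first.
  inR : Word → ℕ → Bool
  inR w t with <-cmp t c
  ... | tri< _ _ _ = at w t xor at w (suc t)
  ... | tri≈ _ _ _ = false
  ... | tri> _ _ _ = at w (pred t) xor at w t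

  inR-< : ∀ w {t} → t < c → inR w t ≡ (at w t xor at w (suc t))
  inR-< w {t} t<c with <-cmp t c
  ... | tri< _ _ _     = refl
  ... | tri≈ t≮c _ _   = contradiction t<c t≮c
  ... | tri> t≮c _ _   = contradiction t<c t≮c

  inR-> : ∀ w {t} → c < t → inR w t ≡ (at w (pred t) xor at w t)
  inR-> w {t} c<t with <-cmp t c
  ... | tri< _ _ c≮t   = contradiction c<t c≮t
  ... | tri≈ _ _ c≮t   = contradiction c<t c≮t
  ... | tri> _ _ _     = refl

  inR-c : ∀ w → inR w c ≡ false
  inR-c w with <-cmp c c
  ... | tri< c<c _ _ = contradiction c<c (<-irrefl refl)
  ... | tri≈ _ _ _   = refl
  ... | tri> _ _ c<c = contradiction c<c (<-irrefl refl)

  Frozen : Word → ℕ → Set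
  Frozen w t = t ≡ c ⊎ inR w t ≡ true

  AgreeOnFrozen : Word → Word → Set
  AgreeOnFrozen w v = ∀ t → t ≤ e → Frozen w t → at v t ≡ at w t

  keeps-left : ∀ w v → AgreeOnFrozen w v → KeepsBlockStarts (leftRay w) (leftRay v) c
  keeps-left w _ agree t t<c switch =
    agree p (≤-trans (m∸n≤m c (suc t)) c≤e) (inj₂ (trans (inR-< w p<c) (≢⇒xor≡true p-switch)))
    where
    p = c ∸ suc t
    p<c : p < c
    p<c = ∸-monoʳ-< {c} {suc t} {0} (s≤s z≤n) t<c
    p-switch : at w p ≢ at w (suc p)
    p-switch eq = switch (sym (trans eq (cong (at w) (sym (+-∸-assoc 1 t<c)))))

  keeps-right : ∀ w v → AgreeOnFrozen w v → KeepsBlockStarts (rightRay w) (rightRay v) m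
  keeps-right w _ agree t t<m switch =
    agree (c + suc t) (≤-trans (+-monoʳ-≤ c t<m) (≤-reflexive c+m≡e))
          (inj₂ (trans (inR-> w (m<m+n c (s≤s z≤n))) (≢⇒xor≡true p-switch)))
    where
    p-switch : at w (pred (c + suc t)) ≢ at w (c + suc t)
    p-switch rewrite +-suc c t = switch

  head-left : ∀ w v → AgreeOnFrozen w v → leftRay w 0 ≡ leftRay v 0
  head-left w v agree = sym (agree c c≤e (inj₁ refl))

  head-right : ∀ w v → AgreeOnFrozen w v → rightRay w 0 ≡ rightRay v 0
  head-right w v agree rewrite +-identityʳ c = sym (agree c c≤e (inj₁ refl))

  switches-rays : ∀ w → switches (at w) e ≡ switches (leftRay w) c + switches (rightRay w) m
  switches-rays w = begin
    switches (at w) e                                     ≡⟨ cong (switches (at w)) c+m≡e ⟨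
    switches (at w) (c + m)                               ≡⟨ switches-split c m (at w) ⟩
    switches (at w) c + switches (rightRay w) m           ≡⟨ cong (_+ switches (rightRay w) m) (switches-reverse c (at w)) ⟨
    switches (leftRay w) c + switches (rightRay w) m      ∎
    where open ≡-Reasoning

  switches-mono-frozen : ∀ {w v} → AgreeOnFrozen w v → switches (at w) e ≤ switches (at v) e
  switches-mono-frozen {w} {v} agree = begin
    switches (at w) e                                ≡⟨ switches-rays w ⟩
    switches (leftRay w) c + switches (rightRay w) m ≤⟨ +-mono-≤ left right ⟩
    switches (leftRay v) c + switches (rightRay v) m ≡⟨ switches-rays v ⟨
    switches (at v) e                                ∎
    where
    open ≤-Reasoning
    left : switches (leftRay w) c ≤ switches (leftRay v) c
    left = switches-mono c (leftRay w) (leftRay v) (head-left w v agree) (keeps-left w v agree)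
    right : switches (rightRay w) m ≤ switches (rightRay v) m
    right = switches-mono m (rightRay w) (rightRay v) (head-right w v agree) (keeps-right w v agree)

  rank-minimal : ∀ {w v} → AgreeOnFrozen w v → rank w ≤ rank v × (rank w ≡ rank v → v ≡ w)
  rank-minimal {w} {v} agree = +-mono-≤ (*-monoˡ-≤ (2 ^ m) (proj₁ left)) (proj₁ right) , rank≡⇒≡
    where
    left : SwitchCodeBelow (leftRay w) (leftRay v) c
    left = switchCode-minimal c (leftRay w) (leftRay v) (head-left w v agree) (keeps-left w v agree)
    right : SwitchCodeBelow (rightRay w) (rightRay v) m
    right = switchCode-minimal m (rightRay w) (rightRay v) (head-right w v agree) (keeps-right w v agree)
    rank≡⇒≡ : rank w ≡ rank v → v ≡ w
    rank≡⇒≡ eq = at-ext v w same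
      where
      codes : switchCode (leftRay w) c ≡ switchCode (leftRay v) c × switchCode (rightRay w) m ≡ switchCode (rightRay v) m
      codes = digits-≡ m (proj₁ left) (switchCode<2^n m (rightRay w)) eq
      same : ∀ t → t < suc e → at v t ≡ at w t
      same t t<e+1 with t ≤? c
      ... | yes t≤c = subst (λ r → at v r ≡ at w r) (m∸[m∸n]≡n t≤c)
                        (proj₂ left (proj₁ codes) (c ∸ t) (m∸n≤m c t))
      ... | no t≰c  = subst (λ r → at v r ≡ at w r) (m+[n∸m]≡n (≰⇒≥ t≰c))
                        (proj₂ right (proj₂ codes) (t ∸ c) (∸-monoˡ-≤ c (≤-pred t<e+1)))

  -- Flipping the isolated letter would give a word that still agrees with w on
  -- the frozen positions but has fewer switches than w.
  no-isolated-unfrozen : ∀ {k w v} → InW k w → InW k v → AgreeOnFrozen w v →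
                         ∀ p → p ≤ e → ¬ Frozen w p → ¬ Isolated (at v) e p
  no-isolated-unfrozen {k} {w} {v} inW-w inW-v agree p p≤e unfrozen isolated =
    <-irrefl refl (begin-strict
      switches (at w) e   ≤⟨ switches-mono-frozen {w} {v′} agree′ ⟩
      switches (at v′) e  <⟨ switches-isolated-< p e (at v) (at v′) p≤e 0<e isolated (at-flipAt-≢ p v) flipped ⟩
      switches (at v) e   ≡⟨ trans (proj₂ (InW⇒at v inW-v)) (sym (proj₂ (InW⇒at w inW-w))) ⟩
      switches (at w) e   ∎)
    where
    open ≤-Reasoning
    v′ = flipAt p v
    agree′ : AgreeOnFrozen w v′
    agree′ t t≤e frozen =
      trans (at-flipAt-≢ p v t (λ t≡p → unfrozen (subst (Frozen w) t≡p frozen))) (agree t t≤e frozen)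
    flipped : at v′ p ≢ at v p
    flipped eq = not-¬ refl (trans (sym eq) (at-flipAt-≡ p v (s≤s p≤e)))
    0<e : 0 < e
    0<e = n≢0⇒n>0 λ e≡0 → unfrozen (inj₁ (trans (n≤0⇒n≡0 (subst (p ≤_) e≡0 p≤e))
                                               (sym (n≤0⇒n≡0 (subst (c ≤_) e≡0 c≤e)))))

  rank-drop-left : ∀ w v q → q < c → (∀ t → q < t → t ≤ c → at v t ≡ at w t) →
                   at w q ≢ at w (suc q) → at v q ≡ at v (suc q) → rank v < rank w
  rank-drop-left w v q q<c agree w-switches v-stays =
    leading-digit-< m _ _ _ _ (switchCode-drop c (leftRay w) (leftRay v) s s<c agree-ray w-switches′ v-stays′)
                    (switchCode<2^n m (rightRay v))
    where
    s = c ∸ suc q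
    s<c : s < c
    s<c = ∸-monoʳ-< {c} {suc q} {0} (s≤s z≤n) q<c
    c∸s≡q+1 : c ∸ s ≡ suc q
    c∸s≡q+1 = m∸[m∸n]≡n q<c
    c∸[s+1]≡q : c ∸ suc s ≡ q
    c∸[s+1]≡q = trans (cong (c ∸_) (sym (+-∸-assoc 1 q<c))) (m∸[m∸n]≡n (<⇒≤ q<c))
    agree-ray : ∀ u → u ≤ s → leftRay v u ≡ leftRay w u
    agree-ray u u≤s = agree (c ∸ u) (≤-trans (≤-reflexive (sym c∸s≡q+1)) (∸-monoʳ-≤ c u≤s)) (m∸n≤m c u)
    w-switches′ : leftRay w s ≢ leftRay w (suc s)
    w-switches′ eq = w-switches (sym (subst₂ (λ x y → at w x ≡ at w y) c∸s≡q+1 c∸[s+1]≡q eq))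
    v-stays′ : leftRay v s ≡ leftRay v (suc s)
    v-stays′ = subst₂ (λ x y → at v x ≡ at v y) (sym c∸s≡q+1) (sym c∸[s+1]≡q) (sym v-stays)

  rank-drop-right : ∀ w v q → c < q → q ≤ e → (∀ t → t < q → at v t ≡ at w t) →
                    at w (pred q) ≢ at w q → at v (pred q) ≡ at v q → rank v < rank w
  rank-drop-right w v (suc q) (s≤s c≤q) q<e agree w-switches v-stays = begin-strict
    rank v                                                  ≡⟨ cong (λ x → x * 2 ^ m + switchCode (rightRay v) m) left≡ ⟩
    switchCode (leftRay w) c * 2 ^ m + switchCode (rightRay v) m
      <⟨ +-monoʳ-< _ (switchCode-drop m (rightRay w) (rightRay v) s s<m agree-ray w-switches′ v-stays′) ⟩
    rank w                                                  ∎
    where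
    open ≤-Reasoning
    s = q ∸ c
    c+s≡q : c + s ≡ q
    c+s≡q = m+[n∸m]≡n c≤q
    c+[s+1]≡q+1 : c + suc s ≡ suc q
    c+[s+1]≡q+1 = trans (+-suc c s) (cong suc c+s≡q)
    s<m : s < m
    s<m = ∸-monoˡ-< q<e c≤q
    left≡ : switchCode (leftRay v) c ≡ switchCode (leftRay w) c
    left≡ = switchCode-cong c (leftRay v) (leftRay w)
              (λ t _ → agree (c ∸ t) (s≤s (≤-trans (m∸n≤m c t) c≤q)))
    agree-ray : ∀ u → u ≤ s → rightRay v u ≡ rightRay w u
    agree-ray u u≤s = agree (c + u) (s≤s (≤-trans (+-monoʳ-≤ c u≤s) (≤-reflexive c+s≡q)))
    w-switches′ : rightRay w s ≢ rightRay w (suc s)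
    w-switches′ eq = w-switches (subst₂ (λ x y → at w x ≡ at w y) c+s≡q c+[s+1]≡q+1 eq)
    v-stays′ : rightRay v s ≡ rightRay v (suc s)
    v-stays′ = subst₂ (λ x y → at v x ≡ at v y) (sym c+s≡q) (sym c+[s+1]≡q+1) v-stays

  data LowerNeighbour (k : ℕ) (w : Word) (l : Fin (suc e)) : Set where
    to-α    : Edge k l (wd w) α → LowerNeighbour k w l
    to-word : ∀ v → Edge k l (wd w) (wd v) → rank v < rank w → LowerNeighbour k w l

  -- Either the letter at l is a block by itself, or flipping it moves the
  -- switch at l one step towards c and lowers the rank.
  lower-left : ∀ {k} w → InW k w → (l : Fin (suc e)) → toℕ l < c →
               at w (toℕ l) ≢ at w (suc (toℕ l)) → LowerNeighbour k w l
  lower-left {k} w inW l q<c switch = go q refl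
    where
    q = toℕ l
    right-differs : q < e → at w (suc q) ≢ at w q
    right-differs _ = switch ∘ sym
    go : ∀ p → p ≡ q → LowerNeighbour k w l
    go zero 0≡q =
      to-α (wα inW (Isolated⇒SingletonBlock w l
        ((λ s s+1≡q → contradiction (trans s+1≡q (sym 0≡q)) 1+n≢0) , right-differs)))
    go (suc p) p+1≡q with at w p ≟ᵇ at w q
    ... | no left-differs =
      to-α (wα inW (Isolated⇒SingletonBlock w l
        ((λ s s+1≡q → subst (λ r → at w r ≢ at w q) (sym (suc-injective (trans s+1≡q (sym p+1≡q)))) left-differs) ,
         right-differs)))
    ... | yes left-same =
      to-word (flipAt q w)
        (flip-edge w inW l p (sym p+1≡q) (≤-trans (subst (_< c) (sym p+1≡q) q<c) c≤e) neighbours-differ)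
        (rank-drop-left w (flipAt q w) q q<c (λ t q<t _ → at-flipAt-≢ q w t (λ t≡q → <-irrefl (sym t≡q) q<t)) switch
          (trans (at-flipAt-≢-neighbour q w q<e+1 (suc q) (switch ∘ sym)) (sym (at-flipAt-≢ q w (suc q) 1+n≢n))))
      where
      q<e+1 : q < suc e
      q<e+1 = toℕ<n l
      neighbours-differ : at w p ≢ at w (suc (suc p))
      neighbours-differ eq = switch (trans (sym left-same) (trans eq (cong (at w ∘ suc) p+1≡q)))

  lower-right : ∀ {k} w → InW k w → (l : Fin (suc e)) → c < toℕ l →
                at w (pred (toℕ l)) ≢ at w (toℕ l) → LowerNeighbour k w l
  lower-right {k} w inW l c<q switch = cases (q <? e)
    where
    q = toℕ l
    p+1≡q : suc (pred q) ≡ q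
    p+1≡q = suc-pred q {{>-nonZero (≤-trans (s≤s z≤n) c<q)}}
    left-differs : ∀ s → suc s ≡ q → at w s ≢ at w q
    left-differs s s+1≡q = subst (λ r → at w (pred r) ≢ at w q) (sym s+1≡q) switch
    isolated : (q < e → at w (suc q) ≢ at w q) → LowerNeighbour k w l
    isolated right-differs = to-α (wα inW (Isolated⇒SingletonBlock w l (left-differs , right-differs)))
    cases : Dec (q < e) → LowerNeighbour k w l
    cases (no q≮e) = isolated (λ q<e → contradiction q<e q≮e)
    cases (yes q<e) with at w q ≟ᵇ at w (suc q)
    ... | no right-differs = isolated (λ _ → right-differs ∘ sym)
    ... | yes right-same =
      to-word (flipAt q w)
        (flip-edge w inW l (pred q) (sym p+1≡q) (subst (_< e) (sym p+1≡q) q<e) neighbours-differ)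
        (rank-drop-right w (flipAt q w) q c<q (<⇒≤ q<e)
          (λ t t<q → at-flipAt-≢ q w t (<⇒≢ t<q)) switch
          (trans (at-flipAt-≢ q w (pred q) (1+n≢n ∘ trans p+1≡q ∘ sym))
                 (sym (at-flipAt-≢-neighbour q w (toℕ<n l) (pred q) switch))))
      where
      neighbours-differ : at w (pred q) ≢ at w (suc (suc (pred q)))
      neighbours-differ eq = switch (trans eq (trans (cong (at w ∘ suc) p+1≡q) (sym right-same)))

  lower-neighbour : ∀ {k} w → InW k w → (l : Fin (suc e)) → inR w (toℕ l) ≡ true → LowerNeighbour k w l
  lower-neighbour w inW l l∈R with <-cmp (toℕ l) c
  ... | tri< l<c _ _ = lower-left w inW l l<c (xor≡true⇒≢ l∈R)
  lower-neighbour w inW l () | tri≈ _ _ _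
  ... | tri> _ _ c<l = lower-right w inW l c<l (xor≡true⇒≢ l∈R)

-- Enumerating W_d(k)

wordsAfter : Bool → (n k : ℕ) → List (Vec Bool n)
wordsAfter b zero    zero    = [] ∷ []
wordsAfter b zero    (suc k) = []
wordsAfter b (suc n) zero    = map (b ∷_) (wordsAfter b n zero)
wordsAfter b (suc n) (suc k) = map (b ∷_) (wordsAfter b n (suc k)) ++ map (not b ∷_) (wordsAfter (not b) n k)

length-wordsAfter : ∀ b n k → length (wordsAfter b n k) ≡ n C k
length-wordsAfter b zero    zero    = refl
length-wordsAfter b zero    (suc k) = refl
length-wordsAfter b (suc n) zero    = trans (length-map (b ∷_) (wordsAfter b n zero)) (length-wordsAfter b n zero)
length-wordsAfter b (suc n) (suc k) = begin
  length (map (b ∷_) (wordsAfter b n (suc k)) ++ map (not b ∷_) (wordsAfter (not b) n k))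
    ≡⟨ length-++ (map (b ∷_) (wordsAfter b n (suc k))) ⟩
  length (map (b ∷_) (wordsAfter b n (suc k))) + length (map (not b ∷_) (wordsAfter (not b) n k))
    ≡⟨ cong₂ _+_ (trans (length-map _ (wordsAfter b n (suc k))) (length-wordsAfter b n (suc k)))
                 (trans (length-map _ (wordsAfter (not b) n k)) (length-wordsAfter (not b) n k)) ⟩
  n C suc k + n C k
    ≡⟨ +-comm (n C suc k) (n C k) ⟩
  n C k + n C suc k
    ≡⟨ nCk+nC[k+1]≡[n+1]C[k+1] n k ⟩
  suc n C suc k
    ∎
  where open ≡-Reasoning

∈-wordsAfter-same : ∀ b {n} k {xs : Vec Bool n} → xs ∈ wordsAfter b n k → (b ∷ xs) ∈ wordsAfter b (suc n) k
∈-wordsAfter-same b zero    xs∈ = ∈-map⁺ (b ∷_) xs∈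
∈-wordsAfter-same b (suc k) xs∈ = ∈-++⁺ˡ (∈-map⁺ (b ∷_) xs∈)

∈-wordsAfter-switch : ∀ b {n} k {xs : Vec Bool n} → xs ∈ wordsAfter (not b) n k →
                      (not b ∷ xs) ∈ wordsAfter b (suc n) (suc k)
∈-wordsAfter-switch b {n} k xs∈ = ∈-++⁺ʳ (map (b ∷_) (wordsAfter b n (suc k))) (∈-map⁺ (not b ∷_) xs∈)

wordsAfter-complete : ∀ b {n} (xs : Vec Bool n) k → changes b xs ≡ k → xs ∈ wordsAfter b n k
wordsAfter-complete b     []           zero    _  = here refl
wordsAfter-complete b     []           (suc k) ()
wordsAfter-complete true  (true  ∷ ys) k       eq = ∈-wordsAfter-same true k (wordsAfter-complete true ys k eq)
wordsAfter-complete false (false ∷ ys) k       eq = ∈-wordsAfter-same false k (wordsAfter-complete false ys k eq)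
wordsAfter-complete true  (false ∷ ys) zero    ()
wordsAfter-complete false (true  ∷ ys) zero    ()
wordsAfter-complete true  (false ∷ ys) (suc k) eq =
  ∈-wordsAfter-switch true k (wordsAfter-complete false ys k (suc-injective eq))
wordsAfter-complete false (true  ∷ ys) (suc k) eq =
  ∈-wordsAfter-switch false k (wordsAfter-complete true ys k (suc-injective eq))

wordsAfter-sound : ∀ b n k {xs : Vec Bool n} → xs ∈ wordsAfter b n k → changes b xs ≡ k
wordsAfter-sound b zero    zero    (here refl) = refl
wordsAfter-sound b (suc n) zero    xs∈ with ∈-map⁻ (b ∷_) xs∈
... | ys , ys∈ , refl = trans (cong (_+ changes b ys) (differ-≡ {b} refl)) (wordsAfter-sound b n zero ys∈)
wordsAfter-sound b (suc n) (suc k) xs∈ with ∈-++⁻ (map (b ∷_) (wordsAfter b n (suc k))) xs∈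
... | inj₁ xs∈₁ with ∈-map⁻ (b ∷_) xs∈₁
...   | ys , ys∈ , refl = trans (cong (_+ changes b ys) (differ-≡ {b} refl)) (wordsAfter-sound b n (suc k) ys∈)
wordsAfter-sound b (suc n) (suc k) xs∈ | inj₂ xs∈₂ with ∈-map⁻ (not b ∷_) xs∈₂
...   | ys , ys∈ , refl =
  trans (cong (_+ changes (not b) ys) (differ-≢ {b} (not-¬ refl))) (cong suc (wordsAfter-sound (not b) n k ys∈))

wordsAfter-unique : ∀ b n k → Unique (wordsAfter b n k)
wordsAfter-unique b zero    zero    = All.[] ∷ []
wordsAfter-unique b zero    (suc k) = []
wordsAfter-unique b (suc n) zero    = Unique.map⁺ ∷-injectiveʳ (wordsAfter-unique b n zero)
wordsAfter-unique b (suc n) (suc k) =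
  Unique.++⁺ (Unique.map⁺ ∷-injectiveʳ (wordsAfter-unique b n (suc k)))
             (Unique.map⁺ ∷-injectiveʳ (wordsAfter-unique (not b) n k)) disjoint
  where
  disjoint : ∀ {v} → ¬ (v ∈ map (b ∷_) (wordsAfter b n (suc k)) × v ∈ map (not b ∷_) (wordsAfter (not b) n k))
  disjoint (v∈₁ , v∈₂) with ∈-map⁻ (b ∷_) v∈₁ | ∈-map⁻ (not b ∷_) v∈₂
  ... | _ , _ , refl | _ , _ , eq = not-¬ refl (∷-injectiveˡ eq)

AllPairs-lookup : ∀ {A : Set} {R : A → A → Set} {xs : List A} → AllPairs R xs →
                  ∀ (j i : Fin (length xs)) → toℕ j < toℕ i → R (List.lookup xs j) (List.lookup xs i)
AllPairs-lookup (px ∷ _)   fzero    (fsuc i) _         = All.lookup px (∈-lookup i)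
AllPairs-lookup (_  ∷ pxs) (fsuc j) (fsuc i) (s≤s j<i) = AllPairs-lookup pxs j i j<i

AllPairs-lookup-< : ∀ {A : Set} (f : A → ℕ) {xs : List A} → AllPairs (λ x y → f x ≤ f y) xs →
                    ∀ (j i : Fin (length xs)) → f (List.lookup xs j) < f (List.lookup xs i) → toℕ j < toℕ i
AllPairs-lookup-< f {xs} sorted j i f<f with <-cmp (toℕ j) (toℕ i)
... | tri< j<i _ _ = j<i
... | tri≈ _ j≡i _ = contradiction (cong (f ∘ List.lookup xs) (toℕ-injective j≡i)) (<⇒≢ f<f)
... | tri> _ _ i<j = contradiction (AllPairs-lookup sorted i j i<j) (<⇒≱ f<f)

count-tabulate : ∀ n (b : ℕ → Bool) → ∣ tabulate {n = n} (b ∘ toℕ) ∣ ≡ count b n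
count-tabulate zero    b = refl
count-tabulate (suc n) b with b 0
... | true  = cong suc (count-tabulate n (b ∘ suc))
... | false = count-tabulate n (b ∘ suc)

module _ {n} {P : Subset n → Set} {R : Subset n} (P-R : P R) (least : ∀ S → P S → R ⊆ S) where

  Minimal-least : ∀ R' → Minimal P R' → R' ≡ R
  Minimal-least R' (P-R' , minimal) = sym (minimal R P-R (least R' P-R'))

  UniqueMinimal-least : UniqueMinimal P
  UniqueMinimal-least = R , (P-R , λ S P-S S⊆R → ⊆-antisym S⊆R (least S P-S)) , Minimal-least

-- The shelling

module Shelling (k e : ℕ) (c : Fin (suc e)) where

  open Rays e (toℕ c) (toℕ≤pred[n] c)
  open import Data.List.Relation.Binary.Permutation.Setoid.Properties (setoid Word) using (Unique-resp-↭)

  byRank : DecTotalOrder _ _ _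
  byRank = On.decTotalOrder ≤-decTotalOrder rank

  open import Data.List.Sort byRank using (sort; sort-↭; sort-↗)
  open DecTotalOrder byRank using (totalOrder)

  words : List Word
  words = map (true ∷_) (wordsAfter true e k)

  InW⇒∈words : ∀ w → InW k w → w ∈ words
  InW⇒∈words (x ∷ xs) (refl , blocks) = ∈-map⁺ (true ∷_) (wordsAfter-complete true xs k (suc-injective blocks))

  ∈words⇒InW : ∀ {w} → w ∈ words → InW k w
  ∈words⇒InW w∈ with ∈-map⁻ (true ∷_) w∈
  ... | xs , xs∈ , refl = refl , cong suc (wordsAfter-sound true e k xs∈)

  ws : List Word
  ws = sort words

  length-ws : length ws ≡ e C k
  length-ws = trans (↭-length (sort-↭ words))
                    (trans (length-map (true ∷_) (wordsAfter true e k)) (length-wordsAfter true e k))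

  ∈ws⇔InW : ∀ w → w ∈ ws ⇔ InW k w
  ∈ws⇔InW w = mk⇔ (∈words⇒InW ∘ ∈-resp-↭ (sort-↭ words))
                  (∈-resp-↭ (↭-sym (sort-↭ words)) ∘ InW⇒∈words w)

  order : List (Vtx (suc e))
  order = α ∷ map wd ws

  vertexRank : Vtx (suc e) → ℕ
  vertexRank α      = 0
  vertexRank (wd w) = suc (rank w)

  wd-injective : ∀ {u v : Word} → wd u ≡ wd v → u ≡ v
  wd-injective refl = refl

  order-unique : Unique order
  order-unique = All.tabulate α∉ ∷ Unique.map⁺ wd-injective
                   (Unique-resp-↭ (↭⇒↭ₛ (↭-sym (sort-↭ words)))
                     (Unique.map⁺ ∷-injectiveʳ (wordsAfter-unique true e k)))
    where
    α∉ : ∀ {x} → x ∈ map wd ws → α ≢ x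
    α∉ x∈ with ∈-map⁻ wd x∈
    ... | _ , _ , refl = λ ()

  order-vertices : ∀ v → (v ∈ order) ⇔ IsVertex k v
  order-vertices v = mk⇔ to from
    where
    to : ∀ {v} → v ∈ order → IsVertex k v
    to (here refl) = tt
    to (there v∈) with ∈-map⁻ wd v∈
    ... | w , w∈ , refl = Equivalence.to (∈ws⇔InW w) w∈
    from : ∀ {v} → IsVertex k v → v ∈ order
    from {α}    _   = here refl
    from {wd w} inW = there (∈-map⁺ wd (Equivalence.from (∈ws⇔InW w) inW))

  order-sorted : AllPairs (λ x y → vertexRank x ≤ vertexRank y) order
  order-sorted = All.tabulate (λ _ → z≤n) ∷
                 AllPairsₚ.map⁺ (AllPairs.map s≤s (Sorted⇒AllPairs totalOrder (sort-↗ words)))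

  colours : Subset (suc e)
  colours = ∁ ⁅ c ⁆

  Rset : Word → Subset (suc e)
  Rset w = tabulate (inR w ∘ toℕ)

  ∈Rset⇒inR : ∀ w {l} → l ∈ₛ Rset w → inR w (toℕ l) ≡ true
  ∈Rset⇒inR w {l} l∈R = trans (sym (lookup∘tabulate (inR w ∘ toℕ) l)) ([]=⇒lookup l∈R)

  inR⇒∈Rset : ∀ w {l} → inR w (toℕ l) ≡ true → l ∈ₛ Rset w
  inR⇒∈Rset w {l} l∈R = lookup⇒[]= l (Rset w) (trans (lookup∘tabulate (inR w ∘ toℕ) l) l∈R)

  Allowed : Subset (suc e) → Fin (suc e) → Set
  Allowed S l = l ∈ₛ colours × ¬ (l ∈ₛ S)

  allowed-unfrozen : ∀ w {l} → Allowed (Rset w) l → ¬ Frozen w (toℕ l)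
  allowed-unfrozen w (l∈colours , _)   (inj₁ l≡c)  =
    x∈∁p⇒x∉p l∈colours (subst (_∈ₛ ⁅ c ⁆) (sym (toℕ-injective l≡c)) (x∈⁅x⁆ c))
  allowed-unfrozen w (_ , l∉R)        (inj₂ l∈R)  = l∉R (inR⇒∈Rset w l∈R)

  inR⇒∈colours : ∀ w {l} → inR w (toℕ l) ≡ true → l ∈ₛ colours
  inR⇒∈colours w {l} l∈R = x∉p⇒x∈∁p (x≢y⇒x∉⁅y⁆ λ l≡c →
    contradiction (trans (sym l∈R) (trans (cong (inR w ∘ toℕ) l≡c) (inR-c w))) λ ())

  KeepsFrozen : Word → Vtx (suc e) → Set
  KeepsFrozen w α      = ⊥
  KeepsFrozen w (wd v) = InW k v × AgreeOnFrozen w v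

  walk-keeps-frozen : ∀ w → InW k w → ∀ {x z} → Walk k (Allowed (Rset w)) x z → KeepsFrozen w x → KeepsFrozen w z
  walk-keeps-frozen w inW here kf = kf
  walk-keeps-frozen w inW (step l allowed (ww {u} {v} _ inW-v differ) rest) (_ , agree) =
    walk-keeps-frozen w inW rest (inW-v , agree′)
    where
    agree′ : AgreeOnFrozen w v
    agree′ t t≤e frozen =
      trans (DifferOnlyAt⇒at {u = u} {v} differ t (s≤s t≤e)
                             (λ t≡l → allowed-unfrozen w allowed (subst (Frozen w) t≡l frozen)))
            (agree t t≤e frozen)
  walk-keeps-frozen w inW (step l allowed (wα {u} _ singleton) rest) (inW-u , agree) =
    ⊥-elim (no-isolated-unfrozen {k} {w} {u} inW inW-u agree (toℕ l) (toℕ≤pred[n] l) (allowed-unfrozen w allowed)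
                                 (SingletonBlock⇒Isolated u l singleton))

  keeps-frozen-rank : ∀ w y → KeepsFrozen w y → vertexRank y ≤ vertexRank (wd w) → y ≡ wd w
  keeps-frozen-rank w (wd v) (_ , agree) v≤w =
    cong wd (proj₂ (rank-minimal {w} {v} agree) (≤-antisym (proj₁ (rank-minimal {w} {v} agree)) (≤-pred v≤w)))

  R-separates : ∀ i w → List.lookup order i ≡ wd w → InW k w → Separates k colours order i (Rset w)
  R-separates i w order[i]≡w inW j j<i walk =
    AllPairs-lookup order-unique j i j<i (trans (keeps-frozen-rank w y keeps y≤w) (sym order[i]≡w))
    where
    y = List.lookup order j
    y≤w : vertexRank y ≤ vertexRank (wd w)
    y≤w = subst (λ x → vertexRank y ≤ vertexRank x) order[i]≡w (AllPairs-lookup order-sorted j i j<i)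
    keeps : KeepsFrozen w y
    keeps = walk-keeps-frozen w inW (subst (λ x → Walk k (Allowed (Rset w)) x (List.lookup order j)) order[i]≡w walk)
                              (inW , λ _ _ _ → refl)

  lower-vertex : ∀ w → InW k w → ∀ l → inR w (toℕ l) ≡ true →
                 Σ (Vtx (suc e)) λ y → Edge k l (wd w) y × vertexRank y < vertexRank (wd w)
  lower-vertex w inW l l∈R with lower-neighbour w inW l l∈R
  ... | to-α edge          = α , edge , s≤s z≤n
  ... | to-word v edge v<w = wd v , edge , s≤s v<w

  edge-target : ∀ {l} {x y : Vtx (suc e)} → Edge k l x y → IsVertex k y
  edge-target (ww _ inW-v _) = inW-v
  edge-target (wα _ _)       = tt
  edge-target (αw inW-w _)   = inW-w

  index-of : ∀ y → IsVertex k y → Σ (Fin (length order)) λ j → List.lookup order j ≡ y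
  index-of y y-vertex = index y∈ , sym (lookup-index y∈)
    where y∈ = Equivalence.from (order-vertices y) y-vertex

  R-least : ∀ i w → List.lookup order i ≡ wd w → InW k w → ∀ S → Separates k colours order i S → Rset w ⊆ S
  R-least i w order[i]≡w inW S separates {l} l∈Rset with l ∈? S
  ... | yes l∈S = l∈S
  ... | no l∉S with lower-vertex w inW l (∈Rset⇒inR w l∈Rset)
  ...   | y , edge , y<w with index-of y (edge-target edge)
  ...     | j , order[j]≡y = ⊥-elim (separates j j<i walk)
    where
    walk : Walk k (Allowed S) (List.lookup order i) (List.lookup order j)
    walk = step l (inR⇒∈colours w (∈Rset⇒inR w l∈Rset) , l∉S)
                (subst₂ (Edge k l) (sym order[i]≡w) (sym order[j]≡y) edge) here
    j<i : toℕ j < toℕ i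
    j<i = AllPairs-lookup-< vertexRank order-sorted j i
            (subst₂ (λ a b → vertexRank a < vertexRank b) (sym order[j]≡y) (sym order[i]≡w) y<w)

  ∣Rset∣≡k : ∀ w → InW k w → ∣ Rset w ∣ ≡ k
  ∣Rset∣≡k w inW = begin
    ∣ Rset w ∣                                                            ≡⟨ count-tabulate (suc e) (inR w) ⟩
    count (inR w) (suc e)                                                 ≡⟨ cong (count (inR w)) c+[m+1]≡e+1 ⟨
    count (inR w) (toℕ c + suc m)                                         ≡⟨ count-split (toℕ c) (suc m) (inR w) ⟩
    count (inR w) (toℕ c) + count (λ t → inR w (toℕ c + t)) (suc m)       ≡⟨ cong₂ _+_ left right ⟩
    switches (at w) (toℕ c) + switches (rightRay w) m                     ≡⟨ switches-split (toℕ c) m (at w) ⟨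
    switches (at w) (toℕ c + m)                                           ≡⟨ cong (switches (at w)) c+m≡e ⟩
    switches (at w) e                                                     ≡⟨ proj₂ (InW⇒at w inW) ⟩
    k                                                                     ∎
    where
    open ≡-Reasoning
    c+[m+1]≡e+1 : toℕ c + suc m ≡ suc e
    c+[m+1]≡e+1 = trans (+-suc (toℕ c) m) (cong suc c+m≡e)
    left : count (inR w) (toℕ c) ≡ switches (at w) (toℕ c)
    left = count-cong (toℕ c) _ _ (λ t t<c → inR-< w t<c)
    right : count (λ t → inR w (toℕ c + t)) (suc m) ≡ switches (rightRay w) m
    right = cong₂ _+_ (cong (λ x → if x then 1 else 0) (trans (cong (inR w) (+-identityʳ (toℕ c))) (inR-c w)))
                      (count-cong m _ _ λ t _ → trans (inR-> w (m<m+n (toℕ c) (s≤s z≤n)))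
                                                       (cong (λ x → at w x xor at w (toℕ c + suc t)) (cong pred (+-suc (toℕ c) t))))

  word-at : ∀ (i : Fin (length order)) → 1 ≤ toℕ i → Σ Word λ w → List.lookup order i ≡ wd w × InW k w
  word-at (fsuc i) _ with ∈-map⁻ wd (∈-lookup {xs = map wd ws} i)
  ... | w , w∈ , order[i]≡w = w , order[i]≡w , Equivalence.to (∈ws⇔InW w) w∈

  shelling : ∀ i → UniqueMinimal (Separates k colours order i)
  shelling fzero = UniqueMinimal-least (λ _ ()) (λ _ _ → ⊥⊆)
  shelling (fsuc i) with word-at (fsuc i) (s≤s z≤n)
  ... | w , order[i]≡w , inW = UniqueMinimal-least (R-separates _ w order[i]≡w inW) (R-least _ w order[i]≡w inW)

  ∣minimal∣≡k : ∀ i → 1 ≤ toℕ i → ∀ R → Minimal (Separates k colours order i) R → ∣ R ∣ ≡ k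
  ∣minimal∣≡k i 1≤i R minimal with word-at i 1≤i
  ... | w , order[i]≡w , inW =
    trans (cong ∣_∣ (Minimal-least (R-separates i w order[i]≡w inW) (R-least i w order[i]≡w inW) R minimal))
          (∣Rset∣≡k w inW)

theorem4p13 : (k d : ℕ) → 1 ≤ k → k < d → (c : Fin d) →
    Σ (List (Vec Bool d)) λ ws →
      length ws ≡ (d ∸ 1) C k ×
      IsGraphicalShelling k (∁ ⁅ c ⁆) (α ∷ map wd ws) ×
      (∀ (i : Fin (length (α ∷ map wd ws))) → 1 ≤ toℕ i →
        ∀ R → Minimal (Separates k (∁ ⁅ c ⁆) (α ∷ map wd ws) i) R → ∣ R ∣ ≡ k)
theorem4p13 k zero    _ _ ()
theorem4p13 k (suc e) _ _ c =
  ws , length-ws , ((order-unique , order-vertices) , shelling) , ∣minimal∣≡k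
  where open Shelling k e c
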